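{- Let $G$ be a finite simple graph with a proper edge coloring $\kappa$. Then $\mathfrak{G}_\kappa\subseteq C_{S_{V(G)}}(\operatorname{Aut}_\kappa(G))$. In particular, a necessary condition for $\mathfrak{G}_\kappa\cong S_{V(G)}$ is that $\operatorname{Aut}_\kappa(G)$ is trivial.
   Context: A proper edge coloring of $G$ on $k$ colors is a surjective map $\kappa:E(G)\to[k]$ such that edges sharing a vertex receive different colors. For $a\in[k]$, $\tau_a\in S_{V(G)}$ is the product of the transpositions $(i,j)$ over all edges $\{i,j\}$ colored $a$, and the coloring group $\mathfrak{G}_\kappa\le S_{V(G)}$ is the subgroup generated by $\tau_1,\dots,\tau_k$. $\operatorname{Aut}_\kappa(G)$ is the group of permutations $\sigma\in S_{V(G)}$ such that for every color $a$, $\{i,j\}$ is an edge colored $a$ iff $\{\sigma(i),\sigma(j)\}$ is an edge colored $a$. $C_{S_{V(G)}}(H)$ denotes the centralizer of $H$ in $S_{V(G)}$. -}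

module Defs where

open import Data.Nat using (ℕ)
open import Data.Fin using (Fin; zero; suc)
open import Data.Fin.Properties using () renaming (_≟_ to _≟ᶠ_)
open import Data.Maybe using (Maybe; just; nothing)
open import Data.Maybe.Properties using (≡-dec)
open import Data.Product using (Σ; ∃; _×_; _,_)
open import Function using (_∘_; id)
open import Function.Bundles using (_⇔_)
open import Data.Fin.Permutation using (Permutation′; _⟨$⟩ʳ_)
open import Relation.Nullary using (yes; no)
open import Relation.Binary.PropositionalEquality using (_≡_)

-- An edge-coloured finite simple graph on vertex set V(G) = Fin n with
-- colours in [k] = Fin k is encoded by  col : Fin n → Fin n → Maybe (Fin k):
-- {i,j} is an edge of colour a  iff  col i j ≡ just a, and a non-edge iff
-- col i j ≡ nothing.
Colouring : ℕ → ℕ → Set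
Colouring n k = Fin n → Fin n → Maybe (Fin k)

record IsProperEdgeColouring {n k : ℕ} (col : Colouring n k) : Set where
  field
    symmetric  : ∀ i j → col i j ≡ col j i
    loopless   : ∀ i → col i i ≡ nothing
    proper     : ∀ i j l a → col i j ≡ just a → col i l ≡ just a → j ≡ l
    surjective : ∀ (a : Fin k) → ∃ λ i → ∃ λ j → col i j ≡ just a

find : ∀ {m k} → (Fin m → Maybe (Fin k)) → Fin k → Maybe (Fin m)
find {ℕ.zero}  f a = nothing
find {ℕ.suc m} f a with ≡-dec _≟ᶠ_ (f zero) (just a)
... | yes _ = just zero
... | no  _ with find (f ∘ suc) a
...   | just j  = just (suc j)
...   | nothing = nothing

-- τ_a : the product of the transpositions (i j) over edges {i,j} of colour a.
-- (For a proper colouring these transpositions are disjoint, so τ_a sends i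
-- to its a-coloured neighbour if it has one, and fixes i otherwise.)
τ : ∀ {n k} → Colouring n k → Fin k → Fin n → Fin n
τ col a i with find (col i) a
... | just j  = j
... | nothing = i

-- The subgroup of S_{Fin n} generated by the τ_a, as an inductive predicate
-- on maps Fin n → Fin n (closed under identity, generators, composition,
-- inverses, and pointwise equality).
data InGen {n k : ℕ} (col : Colouring n k) : (Fin n → Fin n) → Set where
  gen-id  : InGen col id
  gen-τ   : ∀ a → InGen col (τ col a)
  gen-∘   : ∀ {f g} → InGen col f → InGen col g → InGen col (f ∘ g)
  gen-inv : ∀ {f g} → InGen col g → (∀ x → f (g x) ≡ x) → (∀ x → g (f x) ≡ x)
          → InGen col f
  gen-ext : ∀ {f g} → InGen col f → (∀ x → f x ≡ g x) → InGen col g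

_∈𝔊_ : ∀ {n k} → Permutation′ n → Colouring n k → Set
σ ∈𝔊 col = InGen col (σ ⟨$⟩ʳ_)

_∈Aut_ : ∀ {n k} → Permutation′ n → Colouring n k → Set
σ ∈Aut col = ∀ i j a → (col i j ≡ just a) ⇔ (col (σ ⟨$⟩ʳ i) (σ ⟨$⟩ʳ j) ≡ just a)

_∈Centraliser_ : ∀ {n} → Permutation′ n → (Permutation′ n → Set) → Set
g ∈Centraliser H = ∀ σ → H σ → ∀ x → g ⟨$⟩ʳ (σ ⟨$⟩ʳ x) ≡ σ ⟨$⟩ʳ (g ⟨$⟩ʳ x)

Trivial : ∀ {n} → (Permutation′ n → Set) → Set
Trivial H = ∀ σ → H σ → ∀ x → σ ⟨$⟩ʳ x ≡ x

{-# OPTIONS --safe #-}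
-- An automorphism σ of the coloured graph sends the a-coloured neighbour of x
-- to the a-coloured neighbour of σ x, so σ commutes with every τ_a and hence
-- with the whole group they generate. If that group is all of S_n, every
-- automorphism is central in S_n, and for n ≥ 3 the centre of S_n is trivial:
-- if σ x ≠ x, pick z ∉ {x, σ x}; the transposition t = (x z) fixes σ x, so
-- σ x = t (σ x) = σ (t x) = σ z, contradicting injectivity of σ.
module Submission where

open import Defs
open import Data.Nat using (ℕ; _≤_; s≤s)
open import Data.Product using (_×_; _,_; ∃)
open import Data.Fin using (Fin; zero; suc)
open import Data.Fin.Properties using () renaming (_≟_ to _≟ᶠ_)
open import Data.Maybe using (Maybe; just; nothing)
open import Data.Maybe.Properties using (≡-dec)
open import Data.Fin.Permutation using (Permutation′; _⟨$⟩ʳ_; _⟨$⟩ˡ_; inverseʳ; transpose)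
import Data.Fin.Permutation.Components as PC
open import Function using (_∘_; Injection)
open import Function.Bundles using (Equivalence)
open import Function.Properties.Inverse using (↔⇒↣)
open import Relation.Nullary using (yes; no; ¬_)
open import Relation.Nullary.Decidable using (dec-true; dec-false)
open import Data.Empty using (⊥-elim)
open import Relation.Binary.PropositionalEquality

find-just : ∀ {m k} (f : Fin m → Maybe (Fin k)) a j → find f a ≡ just j → f j ≡ just a
find-just {ℕ.suc m} f a j eq with ≡-dec _≟ᶠ_ (f zero) (just a)
find-just {ℕ.suc m} f a .zero refl | yes p = p
... | no _ with find (f ∘ suc) a in e
find-just {ℕ.suc m} f a .(suc j) refl | no _ | just j = find-just (f ∘ suc) a j e

find-nothing : ∀ {m k} (f : Fin m → Maybe (Fin k)) a → find f a ≡ nothing → ∀ j → ¬ f j ≡ just a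
find-nothing {ℕ.suc m} f a eq j fj with ≡-dec _≟ᶠ_ (f zero) (just a)
find-nothing {ℕ.suc m} f a () j fj | yes _
... | no np with find (f ∘ suc) a in e
find-nothing {ℕ.suc m} f a () j fj | no np | just _
find-nothing {ℕ.suc m} f a refl zero fj | no np | nothing = np fj
find-nothing {ℕ.suc m} f a refl (suc j) fj | no np | nothing = find-nothing (f ∘ suc) a e j fj

module _ {n k : ℕ} (col : Colouring n k) where

  τ-unmatched : ∀ a i → (∀ j → ¬ col i j ≡ just a) → τ col a i ≡ i
  τ-unmatched a i h with find (col i) a in e
  ... | just j  = ⊥-elim (h j (find-just (col i) a j e))
  ... | nothing = refl

  InGen-commutes : ∀ (s : Fin n → Fin n) → (∀ a x → τ col a (s x) ≡ s (τ col a x))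
    → ∀ {f} → InGen col f → ∀ x → f (s x) ≡ s (f x)
  InGen-commutes s τ-s gen-id x = refl
  InGen-commutes s τ-s (gen-τ a) x = τ-s a x
  InGen-commutes s τ-s (gen-∘ {f} {g} p q) x = begin
    f (g (s x)) ≡⟨ cong f (InGen-commutes s τ-s q x) ⟩
    f (s (g x)) ≡⟨ InGen-commutes s τ-s p (g x) ⟩
    s (f (g x)) ∎
    where open ≡-Reasoning
  InGen-commutes s τ-s (gen-inv {f} {g} p fg gf) x = begin
    f (s x)         ≡⟨ cong (f ∘ s) (gf x) ⟨
    f (s (g (f x))) ≡⟨ cong f (InGen-commutes s τ-s p (f x)) ⟨
    f (g (s (f x))) ≡⟨ fg (s (f x)) ⟩
    s (f x)         ∎
    where open ≡-Reasoning
  InGen-commutes s τ-s (gen-ext {f} {g} p f≗g) x = begin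
    g (s x) ≡⟨ f≗g (s x) ⟨
    f (s x) ≡⟨ InGen-commutes s τ-s p x ⟩
    s (f x) ≡⟨ cong s (f≗g x) ⟩
    s (g x) ∎
    where open ≡-Reasoning

  module _ (P : IsProperEdgeColouring col) where
    open IsProperEdgeColouring P

    τ-matched : ∀ a i j → col i j ≡ just a → τ col a i ≡ j
    τ-matched a i j c with find (col i) a in e
    ... | just j′ = proper i j′ j a (find-just (col i) a j′ e) c
    ... | nothing = ⊥-elim (find-nothing (col i) a e j c)

    ∈Aut⇒τ-commutes : ∀ (σ : Permutation′ n) → σ ∈Aut col
      → ∀ a x → τ col a (σ ⟨$⟩ʳ x) ≡ σ ⟨$⟩ʳ (τ col a x)
    ∈Aut⇒τ-commutes σ aut a x with find (col x) a in e
    ... | just j  = τ-matched a _ _ (Equivalence.to (aut x j a) (find-just (col x) a j e))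
    ... | nothing = τ-unmatched a _ σx-unmatched
      where
      σx-unmatched : ∀ j → ¬ col (σ ⟨$⟩ʳ x) j ≡ just a
      σx-unmatched j c = find-nothing (col x) a e (σ ⟨$⟩ˡ j)
        (Equivalence.from (aut x (σ ⟨$⟩ˡ j) a)
          (subst (λ t → col (σ ⟨$⟩ʳ x) t ≡ just a) (sym (inverseʳ σ)) c))

avoid-two : ∀ {m} (x y : Fin (ℕ.suc (ℕ.suc (ℕ.suc m)))) → ∃ λ z → ¬ z ≡ x × ¬ z ≡ y
avoid-two zero zero = suc zero , (λ ()) , (λ ())
avoid-two zero (suc zero) = suc (suc zero) , (λ ()) , (λ ())
avoid-two zero (suc (suc y)) = suc zero , (λ ()) , (λ ())
avoid-two (suc zero) zero = suc (suc zero) , (λ ()) , (λ ())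
avoid-two (suc (suc x)) zero = suc zero , (λ ()) , (λ ())
avoid-two (suc x) (suc y) = zero , (λ ()) , (λ ())

transpose-matchˡ : ∀ {n} (i j : Fin n) → PC.transpose i j i ≡ j
transpose-matchˡ i j rewrite dec-true (i ≟ᶠ i) refl = refl

transpose-other : ∀ {n} (i j k : Fin n) → ¬ k ≡ i → ¬ k ≡ j → PC.transpose i j k ≡ k
transpose-other i j k k≢i k≢j rewrite dec-false (k ≟ᶠ i) k≢i | dec-false (k ≟ᶠ j) k≢j = refl

central⇒identity : ∀ {n} → 3 ≤ n → (σ : Permutation′ n)
  → (∀ (g : Permutation′ n) x → g ⟨$⟩ʳ (σ ⟨$⟩ʳ x) ≡ σ ⟨$⟩ʳ (g ⟨$⟩ʳ x))
  → ∀ x → σ ⟨$⟩ʳ x ≡ x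
central⇒identity (s≤s (s≤s (s≤s _))) σ central x with σ ⟨$⟩ʳ x ≟ᶠ x
... | yes σx≡x = σx≡x
... | no σx≢x with avoid-two x (σ ⟨$⟩ʳ x)
... | z , z≢x , z≢σx = ⊥-elim (z≢x (sym (Injection.injective (↔⇒↣ σ) σx≡σz)))
  where
  open ≡-Reasoning
  σx≡σz : σ ⟨$⟩ʳ x ≡ σ ⟨$⟩ʳ z
  σx≡σz = begin
    σ ⟨$⟩ʳ x                               ≡⟨ transpose-other x z _ σx≢x (z≢σx ∘ sym) ⟨
    transpose x z ⟨$⟩ʳ (σ ⟨$⟩ʳ x)           ≡⟨ central (transpose x z) x ⟩
    σ ⟨$⟩ʳ (transpose x z ⟨$⟩ʳ x)           ≡⟨ cong (σ ⟨$⟩ʳ_) (transpose-matchˡ x z) ⟩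
    σ ⟨$⟩ʳ z                               ∎

corollary3p2 : ∀ (n k : ℕ) (col : Colouring n k) → IsProperEdgeColouring col
    → (∀ (g : Permutation′ n) → g ∈𝔊 col → g ∈Centraliser (λ σ → σ ∈Aut col))
    × (3 ≤ n → (∀ (g : Permutation′ n) → g ∈𝔊 col) → Trivial (λ σ → σ ∈Aut col))
corollary3p2 n k col P = 𝔊⊆centraliser , λ 3≤n 𝔊-full σ aut →
  central⇒identity 3≤n σ (λ g → 𝔊⊆centraliser g (𝔊-full g) σ aut)
  where
  𝔊⊆centraliser : ∀ (g : Permutation′ n) → g ∈𝔊 col → g ∈Centraliser (λ σ → σ ∈Aut col)
  𝔊⊆centraliser g g∈𝔊 σ aut =
    InGen-commutes col (σ ⟨$⟩ʳ_) (∈Aut⇒τ-commutes col P σ aut) g∈𝔊
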